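{- For every integer $n \ge 1$, any polynomial $P(X_1,\ldots,X_n) \in \mathbb{R}[X_1,\ldots,X_n]$ (of arbitrary degree) that sign represents the parity function over $\{1,2\}^n$ has sparsity at least $n+1$.
   Context: For $A \subseteq \mathbb{Z}$, the parity function $\mathrm{Par}: A^n \to \{0,1\}$ is $\mathrm{Par}(a_1,\ldots,a_n) = \sum_{i=1}^n a_i \bmod 2$. A polynomial $P$ sign represents $f: A^n \to \{0,1\}$ if for every $a \in A^n$: $f(a) = 0 \Rightarrow P(a) > 0$ and $f(a) = 1 \Rightarrow P(a) < 0$. The sparsity of $P$ is the number of monomials with nonzero coefficient in the standard monomial basis. -}

module Defs where

open import Data.Nat as ℕ using (ℕ; zero; suc)
open import Data.Nat.DivMod using (_%_)
open import Data.Fin using (Fin; toℕ)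
open import Data.Vec using (Vec; []; _∷_)
open import Data.List using (List; []; _∷_; map; length)
open import Data.List.Relation.Unary.All using (All)
open import Data.List.Relation.Unary.Unique.Propositional using (Unique)
open import Data.Product using (Σ; _×_; _,_; proj₁; proj₂; ∃)
open import Data.Sum using (_⊎_)
open import Relation.Binary.PropositionalEquality using (_≡_)
open import Relation.Nullary using (¬_)

-- The real numbers, axiomatised as a Dedekind-complete ordered field
-- (unique up to isomorphism, so quantifying over all of them = speaking about ℝ).
record RealField : Set₁ where
  infixl 6 _+_
  infixl 7 _*_
  infix 4 _<_ _≤_
  field
    Carrier : Set
    _+_ _*_ : Carrier → Carrier → Carrier
    -_      : Carrier → Carrier
    0# 1#   : Carrier
    _<_     : Carrier → Carrier → Set
    +-assoc : ∀ x y z → (x + y) + z ≡ x + (y + z)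
    +-comm  : ∀ x y → x + y ≡ y + x
    +-identityˡ : ∀ x → 0# + x ≡ x
    -‿inverseˡ : ∀ x → (- x) + x ≡ 0#
    *-assoc : ∀ x y z → (x * y) * z ≡ x * (y * z)
    *-comm  : ∀ x y → x * y ≡ y * x
    *-identityˡ : ∀ x → 1# * x ≡ x
    distribˡ : ∀ x y z → x * (y + z) ≡ (x * y) + (x * z)
    0≢1 : ¬ (0# ≡ 1#)
    inverse : ∀ x → ¬ (x ≡ 0#) → Σ Carrier (λ y → x * y ≡ 1#)
    <-irrefl : ∀ x → ¬ (x < x)
    <-trans  : ∀ {x y z} → x < y → y < z → x < z
    <-trichotomy : ∀ x y → x < y ⊎ (x ≡ y ⊎ y < x)
    +-mono-< : ∀ {x y} z → x < y → x + z < y + z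
    *-pos    : ∀ {x y} → 0# < x → 0# < y → 0# < x * y
  _≤_ : Carrier → Carrier → Set
  x ≤ y = x < y ⊎ x ≡ y
  field
    sup : (S : Carrier → Set) → ∃ S → Σ Carrier (λ b → ∀ x → S x → x ≤ b) →
          Σ Carrier (λ s → (∀ x → S x → x ≤ s) × (∀ b → (∀ x → S x → x ≤ b) → s ≤ b))

module _ (ℝ : RealField) where
  open RealField ℝ

  fromℕ : ℕ → Carrier
  fromℕ zero = 0#
  fromℕ (suc k) = 1# + fromℕ k

  _^_ : Carrier → ℕ → Carrier
  x ^ zero = 1#
  x ^ suc k = x * (x ^ k)

  monomial : ∀ {n} → Vec ℕ n → Vec Carrier n → Carrier
  monomial [] [] = 1#
  monomial (e ∷ es) (x ∷ xs) = (x ^ e) * monomial es xs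

  -- A real polynomial in n variables, in the standard monomial basis:
  -- list of (exponent vector, coefficient) with pairwise distinct exponent
  -- vectors and nonzero coefficients (so each monomial with nonzero
  -- coefficient occurs exactly once).
  record Poly (n : ℕ) : Set where
    field
      terms : List (Vec ℕ n × Carrier)
      distinct : Unique (map proj₁ terms)
      nonzero  : All (λ t → ¬ (proj₂ t ≡ 0#)) terms

  sparsity : ∀ {n} → Poly n → ℕ
  sparsity P = length (Poly.terms P)

  evalTerms : ∀ {n} → List (Vec ℕ n × Carrier) → Vec Carrier n → Carrier
  evalTerms [] x = 0#
  evalTerms ((e , c) ∷ ts) x = c * monomial e x + evalTerms ts x

  eval : ∀ {n} → Poly n → Vec Carrier n → Carrier
  eval P = evalTerms (Poly.terms P)

  -- sign representation of f : A^n → {0,1} (f given as ℕ-valued, values 0/1) (with A ⊆ ℤ given by an embedding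
  -- ι : A → ℝ of its elements)
  SignRepresents : ∀ {n} {A : Set} → (A → Carrier) → Poly n → (Vec A n → ℕ) → Set
  SignRepresents ι P f = ∀ a →
    (f a ≡ 0 → 0# < eval P (Data.Vec.map ι a)) ×
    (f a ≡ 1 → eval P (Data.Vec.map ι a) < 0#)

-- The domain {1,2}: element i : Fin 2 stands for the integer 1 + i.
val12 : Fin 2 → ℕ
val12 i = suc (toℕ i)

sumℕ : ∀ {n} → Vec ℕ n → ℕ
sumℕ [] = 0
sumℕ (x ∷ xs) = x ℕ.+ sumℕ xs

Par12 : ∀ {n} → Vec (Fin 2) n → ℕ
Par12 a = sumℕ (Data.Vec.map val12 a) % 2

-- Let P sign-represent parity on {u, v}ⁿ with u, v > 0, and let
-- x₁ᵈ occur in its first monomial. Then Q(X) = uᵈ P(v, X) − vᵈ P(u, X)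
-- sign-represents parity on {u, v}ⁿ⁻¹: moving x₁ between u and v flips the parity,
-- so both summands have the sign prescribed by X. The first monomial of P cancels
-- in Q, so Q has fewer terms than P; and the empty polynomial is 0, which
-- sign-represents nothing.
module Submission where

open import Defs hiding (_^_)
open import Algebra.Bundles using (CommutativeRing)
open import Algebra.Consequences.Propositional
  using (comm∧idˡ⇒id; comm∧invˡ⇒inv; comm∧distrˡ⇒distrʳ)
open import Data.Bool using (Bool; true; false; not; if_then_else_)
open import Data.Empty using (⊥-elim)
open import Data.Fin using (Fin; zero; suc; toℕ)
open import Data.List using (List; []; _∷_; map; length)
open import Data.List.Properties using (length-map)
open import Data.Nat using (ℕ; zero; suc; z≤n; s≤s)
import Data.Nat as Nat
open import Data.Nat.DivMod using (_%_; %-distribˡ-+; [m+n]%n≡m%n)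
import Data.Nat.Properties as ℕₚ
open import Data.Product using (_×_; _,_; proj₁; proj₂)
open import Data.Sum using (inj₁; inj₂)
open import Data.Vec using (Vec; []; _∷_; replicate)
import Data.Vec as Vec
open import Level using (0ℓ)
open import Relation.Binary.PropositionalEquality
open import Relation.Nullary using (¬_)

-- `zero` stands for the odd value 1 (see val12), so it is the entry that flips the parity.
parity : ∀ {n} → Vec (Fin 2) n → Bool
parity [] = false
parity (zero ∷ a) = not (parity a)
parity (suc zero ∷ a) = parity a

Par12≡parity : ∀ {n} (a : Vec (Fin 2) n) → Par12 a ≡ (if parity a then 1 else 0)
Par12≡parity [] = refl
Par12≡parity (zero ∷ a) = begin
  (1 + s) % 2                    ≡⟨ %-distribˡ-+ 1 s 2 ⟩
  (1 + s % 2) % 2                ≡⟨ cong (λ r → (1 + r) % 2) (Par12≡parity a) ⟩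
  (1 + (if p then 1 else 0)) % 2 ≡⟨ suc-toggles p ⟩
  (if not p then 1 else 0)       ∎
  where
  open ≡-Reasoning
  open Nat using (_+_)
  s : ℕ
  s = sumℕ (Vec.map val12 a)
  p : Bool
  p = parity a
  suc-toggles : ∀ b → (1 + (if b then 1 else 0)) % 2 ≡ (if not b then 1 else 0)
  suc-toggles false = refl
  suc-toggles true = refl
Par12≡parity (suc zero ∷ a) = begin
  (2 + s) % 2                 ≡⟨ cong (_% 2) (ℕₚ.+-comm 2 s) ⟩
  (s + 2) % 2                 ≡⟨ [m+n]%n≡m%n s 2 ⟩
  s % 2                       ≡⟨ Par12≡parity a ⟩
  (if parity a then 1 else 0) ∎
  where
  open ≡-Reasoning
  open Nat using (_+_)
  s : ℕ
  s = sumℕ (Vec.map val12 a)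

module OrderedField (ℝ : RealField) where
  open RealField ℝ public

  commutativeRing : CommutativeRing 0ℓ 0ℓ
  commutativeRing = record
    { isCommutativeRing = record
      { isRing = record
        { +-isAbelianGroup = record
          { isGroup = record
            { isMonoid = record
              { isSemigroup = record
                { isMagma = record { isEquivalence = isEquivalence ; ∙-cong = cong₂ _+_ }
                ; assoc = +-assoc
                }
              ; identity = comm∧idˡ⇒id +-comm +-identityˡ
              }
            ; inverse = comm∧invˡ⇒inv +-comm -‿inverseˡ
            ; ⁻¹-cong = cong -_
            }
          ; comm = +-comm
          }
        ; *-cong = cong₂ _*_
        ; *-assoc = *-assoc
        ; *-identity = comm∧idˡ⇒id *-comm *-identityˡ
        ; distrib = distribˡ , comm∧distrˡ⇒distrʳ *-comm distribˡ
        }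
      ; *-comm = *-comm
      }
    }

  open CommutativeRing commutativeRing public
    using (_-_; +-identityʳ; -‿inverseʳ; zeroˡ; zeroʳ)
  open import Algebra.Properties.Ring (CommutativeRing.ring commutativeRing)
    using (-‿distribˡ-*; -‿distribʳ-*; -‿involutive; -1*x≈-x) public
  open import Algebra.Solver.Ring.NaturalCoefficients.Default
    (CommutativeRing.commutativeSemiring commutativeRing) public
    using (solve; _:=_; _:+_; _:*_)

  0<x⇒-x<0 : ∀ {x} → 0# < x → - x < 0#
  0<x⇒-x<0 {x} 0<x = subst₂ _<_ (+-identityˡ (- x)) (-‿inverseʳ x) (+-mono-< (- x) 0<x)

  x<0⇒0<-x : ∀ {x} → x < 0# → 0# < - x
  x<0⇒0<-x {x} x<0 = subst₂ _<_ (-‿inverseʳ x) (+-identityˡ (- x)) (+-mono-< (- x) x<0)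

  0<-x⇒x<0 : ∀ {x} → 0# < - x → x < 0#
  0<-x⇒x<0 {x} 0<-x = subst₂ _<_ (+-identityˡ x) (-‿inverseˡ x) (+-mono-< x 0<-x)

  +-pos : ∀ {x y} → 0# < x → 0# < y → 0# < x + y
  +-pos {x} {y} 0<x 0<y = <-trans 0<y (subst (_< x + y) (+-identityˡ y) (+-mono-< y 0<x))

  +-neg : ∀ {x y} → x < 0# → y < 0# → x + y < 0#
  +-neg {x} {y} x<0 y<0 = <-trans (subst (x + y <_) (+-identityˡ y) (+-mono-< y x<0)) y<0

  0<1 : 0# < 1#
  0<1 with <-trichotomy 0# 1#
  ... | inj₁ 0<1 = 0<1
  ... | inj₂ (inj₁ 0≡1) = ⊥-elim (0≢1 0≡1)
  ... | inj₂ (inj₂ 1<0) = ⊥-elim (<-irrefl 1# (<-trans 1<0 (subst (0# <_) [-1]*[-1]≡1 (*-pos 0<-1 0<-1))))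
    where
    0<-1 : 0# < - 1#
    0<-1 = x<0⇒0<-x 1<0
    [-1]*[-1]≡1 : (- 1#) * (- 1#) ≡ 1#
    [-1]*[-1]≡1 = trans (-1*x≈-x (- 1#)) (-‿involutive 1#)

  infixr 8 _^_
  _^_ : Carrier → ℕ → Carrier
  _^_ = Defs._^_ ℝ

  ^-pos : ∀ {x} k → 0# < x → 0# < x ^ k
  ^-pos zero 0<x = 0<1
  ^-pos (suc k) 0<x = *-pos 0<x (^-pos k 0<x)

  fromℕ-suc-pos : ∀ k → 0# < fromℕ ℝ (suc k)
  fromℕ-suc-pos zero = subst (0# <_) (sym (+-identityʳ 1#)) 0<1
  fromℕ-suc-pos (suc k) = +-pos 0<1 (fromℕ-suc-pos k)

  HasSign : Bool → Carrier → Set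
  HasSign false x = 0# < x
  HasSign true x = x < 0#

  ¬HasSign-0# : ∀ s → ¬ HasSign s 0#
  ¬HasSign-0# false = <-irrefl 0#
  ¬HasSign-0# true = <-irrefl 0#

  HasSign-+ : ∀ s {x y} → HasSign s x → HasSign s y → HasSign s (x + y)
  HasSign-+ false = +-pos
  HasSign-+ true = +-neg

  HasSign-*-pos : ∀ s {p x} → 0# < p → HasSign s x → HasSign s (p * x)
  HasSign-*-pos false 0<p 0<x = *-pos 0<p 0<x
  HasSign-*-pos true {p} {x} 0<p x<0 =
    0<-x⇒x<0 (subst (0# <_) (sym (-‿distribʳ-* p x)) (*-pos 0<p (x<0⇒0<-x x<0)))

  HasSign-neg : ∀ s {x} → HasSign (not s) x → HasSign s (- x)
  HasSign-neg false = x<0⇒0<-x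
  HasSign-neg true = 0<x⇒-x<0

  HasSign-neg-*-pos : ∀ s {p x} → 0# < p → HasSign (not s) x → HasSign s (- p * x)
  HasSign-neg-*-pos s {p} {x} 0<p x≷0 =
    subst (HasSign s) (-‿distribˡ-* p x) (HasSign-neg s (HasSign-*-pos (not s) 0<p x≷0))

module Polynomials (ℝ : RealField) where
  open OrderedField ℝ
  open ≡-Reasoning

  Terms : ℕ → Set
  Terms n = List (Vec ℕ n × Carrier)

  evalTerms-zero-head : ∀ {n} (es : Vec ℕ n) ts X →
    evalTerms ℝ ((es , 0#) ∷ ts) X ≡ evalTerms ℝ ts X
  evalTerms-zero-head es ts X =
    trans (cong (_+ evalTerms ℝ ts X) (zeroˡ (monomial ℝ es X))) (+-identityˡ (evalTerms ℝ ts X))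

  module Restriction (u v : Carrier) where

    combine : ∀ {n} → Carrier → Carrier → Vec ℕ (suc n) × Carrier → Vec ℕ n × Carrier
    combine α β (e ∷ es , c) = es , c * (α * v ^ e + β * u ^ e)

    evalTerms-map-combine : ∀ {n} α β (ts : Terms (suc n)) X →
      evalTerms ℝ (map (combine α β) ts) X ≡
      α * evalTerms ℝ ts (v ∷ X) + β * evalTerms ℝ ts (u ∷ X)
    evalTerms-map-combine α β [] X =
      sym (trans (cong₂ _+_ (zeroʳ α) (zeroʳ β)) (+-identityˡ 0#))
    evalTerms-map-combine α β ((e ∷ es , c) ∷ ts) X = begin
      c * (α * v ^ e + β * u ^ e) * M + evalTerms ℝ (map (combine α β) ts) X
        ≡⟨ cong (c * (α * v ^ e + β * u ^ e) * M +_) (evalTerms-map-combine α β ts X) ⟩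
      c * (α * v ^ e + β * u ^ e) * M + (α * A + β * B)
        ≡⟨ solve 8 (λ c α β Ve Ue M A B →
             c :* (α :* Ve :+ β :* Ue) :* M :+ (α :* A :+ β :* B) :=
             α :* (c :* (Ve :* M) :+ A) :+ β :* (c :* (Ue :* M) :+ B))
             refl c α β (v ^ e) (u ^ e) M A B ⟩
      α * (c * (v ^ e * M) + A) + β * (c * (u ^ e * M) + B) ∎
      where
      M A B : Carrier
      M = monomial ℝ es X
      A = evalTerms ℝ ts (v ∷ X)
      B = evalTerms ℝ ts (u ∷ X)

    combine-cancels : ∀ {n} d (es : Vec ℕ n) c →
      proj₂ (combine (u ^ d) (- (v ^ d)) (d ∷ es , c)) ≡ 0#
    combine-cancels d es c = begin
      c * (u ^ d * v ^ d + - (v ^ d) * u ^ d)  ≡⟨ cong (λ x → c * (u ^ d * v ^ d + x)) (-‿distribˡ-* (v ^ d) (u ^ d)) ⟨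
      c * (u ^ d * v ^ d + - (v ^ d * u ^ d))  ≡⟨ cong (λ x → c * (u ^ d * v ^ d + - x)) (*-comm (v ^ d) (u ^ d)) ⟩
      c * (u ^ d * v ^ d - u ^ d * v ^ d)      ≡⟨ cong (c *_) (-‿inverseʳ (u ^ d * v ^ d)) ⟩
      c * 0#                                   ≡⟨ zeroʳ c ⟩
      0#                                       ∎

module ParityBound (ℝ : RealField) (ι : Fin 2 → RealField.Carrier ℝ)
                   (ι-pos : ∀ i → RealField._<_ ℝ (RealField.0# ℝ) (ι i)) where
  open OrderedField ℝ
  open Polynomials ℝ

  u v : Carrier
  u = ι zero
  v = ι (suc zero)

  open Restriction u v

  SignRepresentsParity : ∀ {n} → Terms n → Set
  SignRepresentsParity ts = ∀ a → HasSign (parity a) (evalTerms ℝ ts (Vec.map ι a))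

  eliminate : ∀ {n} → ℕ → Vec ℕ (suc n) × Carrier → Vec ℕ n × Carrier
  eliminate d = combine (u ^ d) (- (v ^ d))

  signRepresentsParity-eliminate : ∀ {n} d es c (ts : Terms (suc n)) →
    SignRepresentsParity ((d ∷ es , c) ∷ ts) → SignRepresentsParity (map (eliminate d) ts)
  signRepresentsParity-eliminate d es c ts sr a =
    subst (HasSign (parity a)) value
      (HasSign-+ (parity a)
        (HasSign-*-pos (parity a) (^-pos d (ι-pos zero)) (sr (suc zero ∷ a)))
        (HasSign-neg-*-pos (parity a) (^-pos d (ι-pos (suc zero))) (sr (zero ∷ a))))
    where
    open ≡-Reasoning
    X : Vec Carrier _
    X = Vec.map ι a
    P : Vec Carrier (suc _) → Carrier
    P = evalTerms ℝ ((d ∷ es , c) ∷ ts)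
    value : u ^ d * P (v ∷ X) + - (v ^ d) * P (u ∷ X) ≡ evalTerms ℝ (map (eliminate d) ts) X
    value = begin
      u ^ d * P (v ∷ X) + - (v ^ d) * P (u ∷ X)
        ≡⟨ evalTerms-map-combine (u ^ d) (- (v ^ d)) ((d ∷ es , c) ∷ ts) X ⟨
      evalTerms ℝ (map (eliminate d) ((d ∷ es , c) ∷ ts)) X
        ≡⟨ cong (λ c′ → evalTerms ℝ ((es , c′) ∷ map (eliminate d) ts) X) (combine-cancels d es c) ⟩
      evalTerms ℝ ((es , 0#) ∷ map (eliminate d) ts) X
        ≡⟨ evalTerms-zero-head es (map (eliminate d) ts) X ⟩
      evalTerms ℝ (map (eliminate d) ts) X ∎

  signRepresentsParity⇒n<length : ∀ n (ts : Terms n) → SignRepresentsParity ts → n Nat.< length ts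
  signRepresentsParity⇒n<length n [] sr = ⊥-elim (¬HasSign-0# (parity a) (sr a))
    where
    a : Vec (Fin 2) n
    a = replicate n zero
  signRepresentsParity⇒n<length zero (_ ∷ _) _ = s≤s z≤n
  signRepresentsParity⇒n<length (suc n) ((d ∷ es , c) ∷ ts) sr =
    s≤s (subst (n Nat.<_) (length-map (eliminate d) ts)
      (signRepresentsParity⇒n<length n (map (eliminate d) ts)
        (signRepresentsParity-eliminate d es c ts sr)))

  signRepresents-Par12⇒signRepresentsParity : ∀ {n} (P : Poly ℝ n) →
    SignRepresents ℝ ι P Par12 → SignRepresentsParity (Poly.terms P)
  signRepresents-Par12⇒signRepresentsParity P sr a with parity a | Par12≡parity a
  ... | false | Par12≡0 = proj₁ (sr a) Par12≡0
  ... | true  | Par12≡1 = proj₂ (sr a) Par12≡1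

open Nat using (_≤_; _+_)

corollary5p2 : (ℝ : RealField) → (n : ℕ) → 1 ≤ n → (P : Poly ℝ n) →
    SignRepresents ℝ (λ i → fromℕ ℝ (val12 i)) P Par12 →
    n + 1 ≤ sparsity ℝ P
-- The bound holds for n = 0 as well (P ≠ 0).
corollary5p2 ℝ n _ P sr =
  subst (_≤ sparsity ℝ P) (ℕₚ.+-comm 1 n)
    (signRepresentsParity⇒n<length n (Poly.terms P)
      (signRepresents-Par12⇒signRepresentsParity P sr))
  where
  open OrderedField ℝ using (fromℕ-suc-pos)
  open ParityBound ℝ (λ i → fromℕ ℝ (val12 i)) (λ i → fromℕ-suc-pos (toℕ i))
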